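{- Let $G$ be a finite set of I/O pairs and $(B,Y)$ a pair. Then: $G\vdash_{OUT_1^+}(B,Y)$ iff for every I/O model $(\mathit{In},\mathit{out})$ with $|\mathit{In}|\ge1$, if all pairs of $G$ are 1-2-valid in it then $(B,Y)$ is 1-2-valid in it; $G\vdash_{OUT_2^+}(B,Y)$ iff the same holds for all I/O models with $|\mathit{In}|=1$ (1-2-validity); $G\vdash_{OUT_3^+}(B,Y)$ iff for every I/O model with $|\mathit{In}|\ge1$, 3-4-validity of all pairs of $G$ implies 3-4-validity of $(B,Y)$; $G\vdash_{OUT_4^+}(B,Y)$ iff the same holds for all I/O models with $|\mathit{In}|=1$ (3-4-validity).
   Context: Formulas are classical propositional formulas built with $\top,\bot,\neg,\wedge,\vee,\to$; $\models$ denotes classical semantic entailment. An I/O pair is an ordered pair $(A,X)$ of formulas. Rules on pairs: (TOP) $(\top,\top)$ is derivable from no premises; (BOT) $(\bot,\bot)$ is derivable from no premises; (WO) from $(A,X)$ derive $(A,Y)$ whenever $X\models Y$; (SI) from $(A,X)$ derive $(B,X)$ whenever $B\models A$; (AND) from $(A,X_1)$ and $(A,X_2)$ derive $(A,X_1\wedge X_2)$; (OR) from $(A_1,X)$ and $(A_2,X)$ derive $(A_1\vee A_2,X)$; (CT) from $(A,X)$ and $(A\wedge X,Y)$ derive $(A,Y)$. $OUT_1^+$ = {TOP, BOT, WO, SI, AND}; $OUT_2^+$ = $OUT_1^+$ + OR; $OUT_3^+$ = $OUT_1^+$ + CT; $OUT_4^+$ = $OUT_1^+$ + OR + CT. $G\vdash_{L}(B,Y)$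 means there is a finite tree with root $(B,Y)$, each leaf an element of $G$ or an axiom of $L$, and each non-leaf node obtained from its children by a rule of $L$. A world is a classical truth-value assignment to propositional variables. An I/O model is a pair $(\mathit{In},\mathit{out})$ where $\mathit{out}$ is a world (output world) and $\mathit{In}$ is a set of worlds (input worlds). A pair $(A,X)$ is 1-2-valid in $(\mathit{In},\mathit{out})$ if ($\mathit{in}\models A$ for all $\mathit{in}\in\mathit{In}$) implies $\mathit{out}\models X$. It is 3-4-valid if ($\mathit{in}\models A$ for all $\mathit{in}\in\mathit{In}$) implies $w\models X$ for all $w\in\mathit{In}\cup\{\mathit{out}\}$. -}

module Defs where

open import Data.Nat using (ℕ)
open import Data.Bool using (Bool; true; false; not; _∧_; _∨_)
open import Data.List using (List)
open import Data.List.Membership.Propositional using (_∈_)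
open import Data.Product using (_×_; _,_; Σ; ∃)
open import Relation.Binary.PropositionalEquality using (_≡_; _≗_)
open import Level using (Level; 0ℓ; suc)
open import Relation.Unary using (Pred)

data Formula : Set where
  var  : ℕ → Formula
  ⊤f   : Formula
  ⊥f   : Formula
  ¬f_  : Formula → Formula
  _∧f_ : Formula → Formula → Formula
  _∨f_ : Formula → Formula → Formula
  _⇒f_ : Formula → Formula → Formula

World : Set
World = ℕ → Bool

eval : World → Formula → Bool
eval w (var n)   = w n
eval w ⊤f        = true
eval w ⊥f        = false
eval w (¬f A)    = not (eval w A)
eval w (A ∧f B)  = eval w A ∧ eval w B
eval w (A ∨f B)  = eval w A ∨ eval w B
eval w (A ⇒f B)  = not (eval w A) ∨ eval w B

_⊩_ : World → Formula → Set
w ⊩ A = eval w A ≡ true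

_⊨_ : Formula → Formula → Set
A ⊨ B = (w : World) → w ⊩ A → w ⊩ B

Pair : Set
Pair = Formula × Formula

data System : Set where
  OUT1 OUT2 OUT3 OUT4 : System

hasOR : System → Bool
hasOR OUT1 = false
hasOR OUT2 = true
hasOR OUT3 = false
hasOR OUT4 = true

hasCT : System → Bool
hasCT OUT1 = false
hasCT OUT2 = false
hasCT OUT3 = true
hasCT OUT4 = true

data _⊢[_]_ (G : List Pair) (L : System) : Pair → Set where
  leaf : ∀ {p} → p ∈ G → G ⊢[ L ] p
  TOP  : G ⊢[ L ] (⊤f , ⊤f)
  BOT  : G ⊢[ L ] (⊥f , ⊥f)
  WO   : ∀ {A X Y} → G ⊢[ L ] (A , X) → X ⊨ Y → G ⊢[ L ] (A , Y)
  SI   : ∀ {A B X} → G ⊢[ L ] (A , X) → B ⊨ A → G ⊢[ L ] (B , X)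
  AND  : ∀ {A X₁ X₂} → G ⊢[ L ] (A , X₁) → G ⊢[ L ] (A , X₂)
       → G ⊢[ L ] (A , X₁ ∧f X₂)
  OR   : ∀ {A₁ A₂ X} → hasOR L ≡ true
       → G ⊢[ L ] (A₁ , X) → G ⊢[ L ] (A₂ , X) → G ⊢[ L ] (A₁ ∨f A₂ , X)
  CT   : ∀ {A X Y} → hasCT L ≡ true
       → G ⊢[ L ] (A , X) → G ⊢[ L ] (A ∧f X , Y) → G ⊢[ L ] (A , Y)

record IOModel : Set₁ where
  constructor ⟨_,_⟩
  field
    In  : Pred World 0ℓ
    out : World
open IOModel public

AtLeastOne : IOModel → Set
AtLeastOne M = ∃ λ w → In M w

ExactlyOne : IOModel → Set
ExactlyOne M = ∃ λ w → In M w × ((v : World) → In M v → v ≗ w)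

InSat : IOModel → Formula → Set
InSat M A = (w : World) → In M w → w ⊩ A

valid12 : IOModel → Pair → Set
valid12 M (A , X) = InSat M A → out M ⊩ X

valid34 : IOModel → Pair → Set
valid34 M (A , X) = InSat M A → ((w : World) → In M w → w ⊩ X) × out M ⊩ X

AllValid : (IOModel → Pair → Set) → IOModel → List Pair → Set
AllValid V M G = ∀ {p} → p ∈ G → V M p

SemCons : (IOModel → Set) → (IOModel → Pair → Set) → List Pair → Pair → Set₁
SemCons Cls V G p = (M : IOModel) → Cls M → AllValid V M G → V M p

-- Soundness is a rule-by-rule check: BOT needs a nonempty input set, and OR needs a single
-- input world, in which a true disjunction picks one disjunct.
-- Completeness goes through canonical derivations.  For an input C let H be the conjunction
-- of the heads of the pairs whose body C entails; (C , H) is derivable by SI and AND, and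
-- if C is satisfiable but H does not entail Y, a world satisfying H but not Y is the output
-- of a countermodel.  For OUT1 the input is B itself and the input worlds are all models
-- of B.  With OR, B is first split by cases into inputs C that decide every body of G, and
-- a single model of C serves as input.  With CT the heads become available as inputs too:
-- OUT4 adds H to each case once, while OUT3 iterates, firing the pairs whose body B ∧ C
-- entails, until no pair is left to fire (at most |G| rounds).
module Submission where

open import Defs
open import Data.Bool using (Bool; true; false; not; _∧_; _∨_)
open import Data.Bool.Properties using (∧-conicalˡ; ∧-conicalʳ; ∨-inverseʳ)
open import Data.Empty using (⊥-elim)
open import Data.List using (List; []; _∷_; length; filter; map)
open import Data.List.Membership.Propositional using (_∈_; lose)
open import Data.List.Membership.Propositional.Properties using (∈-filter⁺; ∈-filter⁻; ∈-map⁺)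
open import Data.List.Properties using (filter-notAll)
open import Data.List.Relation.Binary.Subset.Propositional using (_⊆_)
open import Data.List.Relation.Unary.Any as Any using (here; there; any?)
open import Data.Nat using (ℕ; _≟_; zero; suc; _≤_; _<_; _⊔_; z≤n)
open import Data.Nat.Induction using (<-wellFounded)
open import Data.Nat.Properties using (≤-refl; ≤-trans; m≤m⊔n; m≤n⊔m; ≤∧≢⇒<; <⇒≱; <-irrefl; <⇒≤)
open import Data.Product using (_×_; _,_; proj₁; proj₂; ∃)
open import Data.Sum using (_⊎_; inj₁; inj₂; [_,_]′)
open import Function using (_∘_; id)
open import Function.Bundles using (_⇔_; mk⇔)
open import Induction.WellFounded using (Acc; acc)
open import Relation.Binary.PropositionalEquality using (_≡_; refl; sym; trans; cong; cong₂; _≗_)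
open import Relation.Nullary using (¬_; Dec; yes; no; ¬?)
open import Relation.Nullary.Decidable using (map′; _⊎-dec_)
open import Relation.Unary using (Decidable; ∁)
import Data.Bool as Bool

private
  variable
    A A₁ A₂ B C X Y : Formula
    w : World
    G R : List Pair
    L : System
    M : IOModel
    p : Pair

∧-true⁻ : ∀ {a b} → a ∧ b ≡ true → a ≡ true × b ≡ true
∧-true⁻ h = ∧-conicalˡ _ _ h , ∧-conicalʳ _ _ h

∧-true⁺ : ∀ {a b} → a ≡ true → b ≡ true → a ∧ b ≡ true
∧-true⁺ = cong₂ _∧_

∨-true⁻ : ∀ {a b} → a ∨ b ≡ true → a ≡ true ⊎ b ≡ true
∨-true⁻ {true}  _ = inj₁ refl
∨-true⁻ {false} h = inj₂ h

not-true⁻ : ∀ {a} → not a ≡ true → ¬ a ≡ true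
not-true⁻ {false} _ ()

⊩-cases : w ⊩ B → w ⊩ ((B ∧f A) ∨f (B ∧f (¬f A)))
⊩-cases {w} {A = A} wB rewrite wB = ∨-inverseʳ (eval w A)

varBound : Formula → ℕ
varBound (var n) = suc n
varBound ⊤f = 0
varBound ⊥f = 0
varBound (¬f A) = varBound A
varBound (A ∧f B) = varBound A ⊔ varBound B
varBound (A ∨f B) = varBound A ⊔ varBound B
varBound (A ⇒f B) = varBound A ⊔ varBound B

eval-local : ∀ F {n} {v w : World} → varBound F ≤ n → (∀ i → i < n → v i ≡ w i)
           → eval v F ≡ eval w F
eval-local (var m) bound agree = agree m bound
eval-local ⊤f bound agree = refl
eval-local ⊥f bound agree = refl
eval-local (¬f F) bound agree = cong not (eval-local F bound agree)
eval-local (F ∧f F′) bound agree =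
  cong₂ _∧_ (eval-local F (≤-trans (m≤m⊔n _ _) bound) agree)
            (eval-local F′ (≤-trans (m≤n⊔m _ _) bound) agree)
eval-local (F ∨f F′) bound agree =
  cong₂ _∨_ (eval-local F (≤-trans (m≤m⊔n _ _) bound) agree)
            (eval-local F′ (≤-trans (m≤n⊔m _ _) bound) agree)
eval-local (F ⇒f F′) bound agree =
  cong₂ (λ a b → not a ∨ b) (eval-local F (≤-trans (m≤m⊔n _ _) bound) agree)
                            (eval-local F′ (≤-trans (m≤n⊔m _ _) bound) agree)

eval-cong : ∀ F {v w : World} → v ≗ w → eval v F ≡ eval w F
eval-cong F v≗w = eval-local F ≤-refl (λ i _ → v≗w i)

_[_≔_] : World → ℕ → Bool → World
(w [ m ≔ b ]) i with i ≟ m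
... | yes _ = b
... | no _  = w i

AgreeOn : ℕ → ℕ → World → World → Set
AgreeOn k n v w = ∀ i → k ≤ i → i < n → v i ≡ w i

AgreeOn-update⁺ : ∀ {m n} {v w : World} → AgreeOn (suc m) n v w → AgreeOn m n v (w [ m ≔ v m ])
AgreeOn-update⁺ {m} agree i m≤i i<n with i ≟ m
... | yes refl = refl
... | no i≢m   = agree i (≤∧≢⇒< m≤i (i≢m ∘ sym)) i<n

AgreeOn-update⁻ : ∀ {m n b} {v w : World} → AgreeOn m n v (w [ m ≔ b ]) → AgreeOn (suc m) n v w
AgreeOn-update⁻ {m} agree i m<i i<n with i ≟ m | agree i (<⇒≤ m<i) i<n
... | yes refl | _  = ⊥-elim (<-irrefl refl m<i)
... | no _     | eq = eq

Satisfiable : Formula → Set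
Satisfiable C = ∃ λ w → w ⊩ C

SatisfiableNear : Formula → ℕ → World → Set
SatisfiableNear C k w = ∃ λ v → AgreeOn k (varBound C) v w × v ⊩ C

satisfiableNear? : ∀ C k w → Dec (SatisfiableNear C k w)
satisfiableNear? C zero w = map′ (λ wC → w , (λ _ _ _ → refl) , wC) at-w (eval w C Bool.≟ true)
  where
  at-w : SatisfiableNear C zero w → w ⊩ C
  at-w (v , agree , vC) = trans (sym (eval-local C ≤-refl (λ i → agree i z≤n))) vC
satisfiableNear? C (suc m) w =
  map′ [ widen , widen ]′ narrow
       (satisfiableNear? C m (w [ m ≔ true ]) ⊎-dec satisfiableNear? C m (w [ m ≔ false ]))
  where
  widen : ∀ {b} → SatisfiableNear C m (w [ m ≔ b ]) → SatisfiableNear C (suc m) w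
  widen (v , agree , vC) = v , AgreeOn-update⁻ agree , vC
  narrow : SatisfiableNear C (suc m) w
         → SatisfiableNear C m (w [ m ≔ true ]) ⊎ SatisfiableNear C m (w [ m ≔ false ])
  narrow (v , agree , vC) with v m | AgreeOn-update⁺ agree
  ... | true  | agree′ = inj₁ (v , agree′ , vC)
  ... | false | agree′ = inj₂ (v , agree′ , vC)

-- AgreeOn n n is vacuous, so the search around any single world covers all worlds.
satisfiable? : ∀ C → Dec (Satisfiable C)
satisfiable? C = map′ (λ (v , _ , vC) → v , vC)
                      (λ (v , vC) → v , (λ i n≤i i<n → ⊥-elim (<⇒≱ i<n n≤i)) , vC)
                      (satisfiableNear? C (varBound C) (λ _ → false))

_⊨?_ : ∀ A B → Dec (A ⊨ B)
A ⊨? B = map′ entails refutes (¬? (satisfiable? (A ∧f (¬f B))))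
  where
  entails : ¬ Satisfiable (A ∧f (¬f B)) → A ⊨ B
  entails unsat w wA with eval w B in wB
  ... | true  = refl
  ... | false = ⊥-elim (unsat (w , ∧-true⁺ wA (cong not wB)))
  refutes : A ⊨ B → ¬ Satisfiable (A ∧f (¬f B))
  refutes A⊨B (w , h) = let wA , w¬B = ∧-true⁻ h in not-true⁻ w¬B (A⊨B w wA)

exactlyOne⇒atLeastOne : ExactlyOne M → AtLeastOne M
exactlyOne⇒atLeastOne (w , w∈In , _) = w , w∈In

¬InSat-⊥ : AtLeastOne M → ¬ InSat M ⊥f
¬InSat-⊥ (w , w∈In) insat with insat w w∈In
... | ()

InSat-∨ : ExactlyOne M → InSat M (A₁ ∨f A₂) → InSat M A₁ ⊎ InSat M A₂
InSat-∨ {A₁ = A₁} {A₂ = A₂} (w , w∈In , unique) insat with ∨-true⁻ (insat w w∈In)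
... | inj₁ wA₁ = inj₁ λ v v∈In → trans (eval-cong A₁ (unique v v∈In)) wA₁
... | inj₂ wA₂ = inj₂ λ v v∈In → trans (eval-cong A₂ (unique v v∈In)) wA₂

module _ {G : List Pair} {L : System} {M : IOModel}
         (nonempty : AtLeastOne M) (single : hasOR L ≡ true → ExactlyOne M) where

  sound12 : hasCT L ≡ false → AllValid valid12 M G → G ⊢[ L ] p → valid12 M p
  sound12 noCT valid (leaf p∈G) = valid p∈G
  sound12 noCT valid TOP = λ _ → refl
  sound12 noCT valid BOT = λ insat → ⊥-elim (¬InSat-⊥ {M = M} nonempty insat)
  sound12 noCT valid (WO d X⊨Y) = X⊨Y _ ∘ sound12 noCT valid d
  sound12 noCT valid (SI d B⊨A) = λ insat → sound12 noCT valid d (λ v → B⊨A v ∘ insat v)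
  sound12 noCT valid (AND d₁ d₂) insat =
    ∧-true⁺ (sound12 noCT valid d₁ insat) (sound12 noCT valid d₂ insat)
  sound12 noCT valid (OR {A₁} {A₂} or d₁ d₂) =
    [ sound12 noCT valid d₁ , sound12 noCT valid d₂ ]′ ∘ InSat-∨ {M = M} {A₁ = A₁} {A₂} (single or)
  sound12 noCT valid (CT ct d₁ d₂) with trans (sym noCT) ct
  ... | ()

  sound34 : AllValid valid34 M G → G ⊢[ L ] p → valid34 M p
  sound34 valid (leaf p∈G) = valid p∈G
  sound34 valid TOP = λ _ → (λ _ _ → refl) , refl
  sound34 valid BOT = λ insat → ⊥-elim (¬InSat-⊥ {M = M} nonempty insat)
  sound34 valid (WO d X⊨Y) insat =
    let inputs , output = sound34 valid d insat in (λ v → X⊨Y v ∘ inputs v) , X⊨Y _ output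
  sound34 valid (SI d B⊨A) = λ insat → sound34 valid d (λ v → B⊨A v ∘ insat v)
  sound34 valid (AND d₁ d₂) insat =
    let inputs₁ , output₁ = sound34 valid d₁ insat
        inputs₂ , output₂ = sound34 valid d₂ insat
    in (λ v v∈In → ∧-true⁺ (inputs₁ v v∈In) (inputs₂ v v∈In)) , ∧-true⁺ output₁ output₂
  sound34 valid (OR {A₁} {A₂} or d₁ d₂) =
    [ sound34 valid d₁ , sound34 valid d₂ ]′ ∘ InSat-∨ {M = M} {A₁ = A₁} {A₂} (single or)
  sound34 valid (CT _ d₁ d₂) insat =
    let inputs , _ = sound34 valid d₁ insat
    in sound34 valid d₂ (λ v v∈In → ∧-true⁺ (insat v v∈In) (inputs v v∈In))

-- WO may assume that the input is satisfiable: otherwise BOT derives everything.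
⊢-weaken : (Satisfiable C → X ⊨ Y) → G ⊢[ L ] (C , X) → G ⊢[ L ] (C , Y)
⊢-weaken {C} X⊨Y d with satisfiable? C
... | yes C-sat = WO d (X⊨Y C-sat)
... | no C-unsat = WO (SI BOT (λ w wC → ⊥-elim (C-unsat (w , wC)))) (λ _ ())

heads : List Pair → Formula
heads [] = ⊤f
heads ((_ , X) ∷ R) = X ∧f heads R

heads-⊨ : (A , X) ∈ R → heads R ⊨ X
heads-⊨ (here refl) w h = proj₁ (∧-true⁻ h)
heads-⊨ (there m) w h = heads-⊨ m w (proj₂ (∧-true⁻ h))

⊢-⊤ : G ⊢[ L ] (C , ⊤f)
⊢-⊤ = SI TOP (λ _ _ → refl)

⊢-heads : (∀ {A X} → (A , X) ∈ R → G ⊢[ L ] (C , X)) → G ⊢[ L ] (C , heads R)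
⊢-heads {R = []} _ = ⊢-⊤
⊢-heads {R = _ ∷ _} d = AND (d (here refl)) (⊢-heads (d ∘ there))

Fires : Formula → Pair → Set
Fires C (A , _) = C ⊨ A

fires? : ∀ C → Decidable (Fires C)
fires? C (A , _) = C ⊨? A

triggered : Formula → List Pair → List Pair
triggered C = filter (fires? C)

triggered-⊨ : ∀ C → (A , X) ∈ R → C ⊨ A → heads (triggered C R) ⊨ X
triggered-⊨ C m C⊨A = heads-⊨ (∈-filter⁺ (fires? C) m C⊨A)

⊢-triggered : R ⊆ G → G ⊢[ L ] (C , heads (triggered C R))
⊢-triggered {C = C} R⊆G = ⊢-heads λ m →
  let m′ , C⊨A = ∈-filter⁻ (fires? C) m in SI (leaf (R⊆G m′)) C⊨A

Decides : Formula → Formula → Set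
Decides C A = C ⊨ A ⊎ C ⊨ (¬f A)

decided-triggered-⊨ : ∀ C → (∀ {A} → A ∈ map proj₁ G → Decides C A)
                    → (A , X) ∈ G → w ⊩ C → w ⊩ A → heads (triggered C G) ⊨ X
decided-triggered-⊨ C decided m wC wA with decided (∈-map⁺ proj₁ m)
... | inj₁ C⊨A  = triggered-⊨ C m C⊨A
... | inj₂ C⊨¬A = ⊥-elim (not-true⁻ (C⊨¬A _ wC) wA)

by-cases : hasOR L ≡ true → ∀ As
         → (∀ C → C ⊨ B → (∀ {A} → A ∈ As → Decides C A) → G ⊢[ L ] (C , Y))
         → G ⊢[ L ] (B , Y)
by-cases or [] case = case _ (λ _ wB → wB) (λ ())
by-cases {L = L} {B = B} {G = G} {Y = Y} or (A ∷ As) case =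
  SI (OR {A₁ = B ∧f A} {A₂ = B ∧f (¬f A)} or
         (by-cases or As (refine A (λ _ C⊨B∧A → inj₁ (λ w → proj₂ ∘ ∧-true⁻ ∘ C⊨B∧A w))))
         (by-cases or As (refine (¬f A) (λ _ C⊨B∧¬A → inj₂ (λ w → proj₂ ∘ ∧-true⁻ ∘ C⊨B∧¬A w)))))
     (λ _ → ⊩-cases {B = B} {A = A})
  where
  refine : ∀ D → (∀ C → C ⊨ (B ∧f D) → Decides C A)
         → ∀ C → C ⊨ (B ∧f D) → (∀ {A′} → A′ ∈ As → Decides C A′) → G ⊢[ L ] (C , Y)
  refine D decide C C⊨B∧D decided = case C (λ w → proj₁ ∘ ∧-true⁻ ∘ C⊨B∧D w)
    λ { (here refl) → decide C C⊨B∧D ; (there m) → decided m }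

module Saturation (G : List Pair) (B : Formula) where

  Closed : Formula → Set
  Closed C = ∀ {A X} → (A , X) ∈ G → (B ∧f C) ⊨ A → C ⊨ X

  Pending : List Pair → Formula → Set
  Pending R C = ∀ {A X} → (A , X) ∈ G → (A , X) ∈ R ⊎ C ⊨ X

  saturate : ∀ R → Acc _<_ (length R) → R ⊆ G → ∀ C → G ⊢[ OUT3 ] (B , C) → Pending R C
           → ∃ λ C → G ⊢[ OUT3 ] (B , C) × Closed C
  saturate R (acc smaller) R⊆G C d pending with any? (fires? (B ∧f C)) R
  ... | no none = C , d , closed
    where
    closed : Closed C
    closed m B∧C⊨A = [ (λ mR → ⊥-elim (none (lose mR B∧C⊨A))) , id ]′ (pending m)
  ... | yes some = saturate R′ (smaller shorter) (R⊆G ∘ proj₁ ∘ ∈-filter⁻ unfired?) C′ d′ pending′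
    where
    unfired? : Decidable (∁ (Fires (B ∧f C)))
    unfired? = ¬? ∘ fires? (B ∧f C)
    R′ = filter unfired? R
    C′ = C ∧f heads (triggered (B ∧f C) R)
    shorter : length R′ < length R
    shorter = filter-notAll unfired? R (Any.map (λ fires unfired → unfired fires) some)
    d′ : G ⊢[ OUT3 ] (B , C′)
    d′ = AND d (CT refl d (⊢-triggered R⊆G))
    pending′ : Pending R′ C′
    pending′ {A} m with pending m | (B ∧f C) ⊨? A
    ... | inj₂ C⊨X | _ = inj₂ (λ w → C⊨X w ∘ proj₁ ∘ ∧-true⁻)
    ... | inj₁ mR | yes fires = inj₂ (λ w → triggered-⊨ (B ∧f C) mR fires w ∘ proj₂ ∘ ∧-true⁻)
    ... | inj₁ mR | no unfired = inj₁ (∈-filter⁺ unfired? mR unfired)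

singleton : World → World → IOModel
singleton w o = ⟨ _≡ w , o ⟩

singleton-exactlyOne : ∀ w o → ExactlyOne (singleton w o)
singleton-exactlyOne w o = w , refl , λ { v refl _ → refl }

complete1 : SemCons AtLeastOne valid12 G (B , Y) → G ⊢[ OUT1 ] (B , Y)
complete1 {G} {B} {Y} sem = ⊢-weaken countermodel (⊢-triggered id)
  where
  countermodel : Satisfiable B → heads (triggered B G) ⊨ Y
  countermodel (w , wB) o oH =
    sem ⟨ _⊩ B , o ⟩ (w , wB) (λ m B⊨A → triggered-⊨ B m B⊨A o oH) (λ _ → id)

complete2 : SemCons ExactlyOne valid12 G (B , Y) → G ⊢[ OUT2 ] (B , Y)
complete2 {G} {B} {Y} sem = by-cases refl (map proj₁ G) case
  where
  case : ∀ C → C ⊨ B → (∀ {A} → A ∈ map proj₁ G → Decides C A) → G ⊢[ OUT2 ] (C , Y)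
  case C C⊨B decided = ⊢-weaken countermodel (⊢-triggered id)
    where
    countermodel : Satisfiable C → heads (triggered C G) ⊨ Y
    countermodel (w , wC) o oH =
      sem (singleton w o) (singleton-exactlyOne w o)
          (λ m insat → decided-triggered-⊨ C decided m wC (insat w refl) o oH)
          (λ { v refl → C⊨B w wC })

complete3 : SemCons AtLeastOne valid34 G (B , Y) → G ⊢[ OUT3 ] (B , Y)
complete3 {G} {B} {Y} sem with Saturation.saturate G B G (<-wellFounded _) id ⊤f ⊢-⊤ inj₁
... | C , d , closed = CT refl d (⊢-weaken countermodel (SI d (λ _ → proj₁ ∘ ∧-true⁻)))
  where
  countermodel : Satisfiable (B ∧f C) → C ⊨ Y
  countermodel (w , wBC) o oC =
    proj₂ (sem ⟨ _⊩ (B ∧f C) , o ⟩ (w , wBC) valid (λ _ → proj₁ ∘ ∧-true⁻))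
    where
    valid : AllValid valid34 ⟨ _⊩ (B ∧f C) , o ⟩ G
    valid m B∧C⊨A = (λ v → closed m B∧C⊨A v ∘ proj₂ ∘ ∧-true⁻) , closed m B∧C⊨A o oC

complete4 : SemCons ExactlyOne valid34 G (B , Y) → G ⊢[ OUT4 ] (B , Y)
complete4 {G} {B} {Y} sem = by-cases refl (map proj₁ G) case
  where
  case : ∀ C → C ⊨ B → (∀ {A} → A ∈ map proj₁ G → Decides C A) → G ⊢[ OUT4 ] (C , Y)
  case C C⊨B decided = CT refl d (⊢-weaken countermodel (SI d (λ _ → proj₁ ∘ ∧-true⁻)))
    where
    H : Formula
    H = heads (triggered C G)
    d : G ⊢[ OUT4 ] (C , H)
    d = ⊢-triggered id
    countermodel : Satisfiable (C ∧f H) → H ⊨ Y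
    countermodel (w , wCH) o oH =
      proj₂ (sem (singleton w o) (singleton-exactlyOne w o) valid (λ { v refl → C⊨B w wC }))
      where
      wC = proj₁ (∧-true⁻ wCH)
      valid : AllValid valid34 (singleton w o) G
      valid m insat = let H⊨X = decided-triggered-⊨ C decided m wC (insat w refl)
                      in (λ { v refl → H⊨X w (proj₂ (∧-true⁻ wCH)) }) , H⊨X o oH

proposition1 : (G : List Pair) (B Y : Formula) →
    ((G ⊢[ OUT1 ] (B , Y)) ⇔ SemCons AtLeastOne valid12 G (B , Y))
    × ((G ⊢[ OUT2 ] (B , Y)) ⇔ SemCons ExactlyOne valid12 G (B , Y))
    × ((G ⊢[ OUT3 ] (B , Y)) ⇔ SemCons AtLeastOne valid34 G (B , Y))
    × ((G ⊢[ OUT4 ] (B , Y)) ⇔ SemCons ExactlyOne valid34 G (B , Y))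
proposition1 G B Y =
  mk⇔ sound₁ complete1 , mk⇔ sound₂ complete2 , mk⇔ sound₃ complete3 , mk⇔ sound₄ complete4
  where
  sound₁ : G ⊢[ OUT1 ] (B , Y) → SemCons AtLeastOne valid12 G (B , Y)
  sound₁ d M nonempty valid = sound12 nonempty (λ ()) refl valid d
  sound₂ : G ⊢[ OUT2 ] (B , Y) → SemCons ExactlyOne valid12 G (B , Y)
  sound₂ d M exactlyOne valid =
    sound12 (exactlyOne⇒atLeastOne {M = M} exactlyOne) (λ _ → exactlyOne) refl valid d
  sound₃ : G ⊢[ OUT3 ] (B , Y) → SemCons AtLeastOne valid34 G (B , Y)
  sound₃ d M nonempty valid = sound34 nonempty (λ ()) valid d
  sound₄ : G ⊢[ OUT4 ] (B , Y) → SemCons ExactlyOne valid34 G (B , Y)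
  sound₄ d M exactlyOne valid =
    sound34 (exactlyOne⇒atLeastOne {M = M} exactlyOne) (λ _ → exactlyOne) valid d
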